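{- Over the infinite alphabet $\{0,1,2,\ldots\}$, define $Z_0=\epsilon$ and $Z_{n+1}=Z_n\,n\,Z_n$ for $n\ge0$, and let $\mathbf{x}=0102010301020104\cdots$ be the infinite word that is the limit of the $Z_n$ (the ruler sequence). Then $\mathbf{x}$ is squarefree and satisfies $n<\operatorname{nsc}_{\mathbf{x}}(n)\le 2n$ for all $n\ge1$.
   Context: $\epsilon$ is the empty word; each $Z_n$ is a prefix of $Z_{n+1}$. A word is squarefree if it has no nonempty factor of the form $uu$. For an infinite word $\mathbf{x}=x_0x_1x_2\cdots$ (indexed from $0$) and $n\ge1$, $\operatorname{nsc}_{\mathbf{x}}(n)=\max\{m\in\mathbb{N}: x_i\cdots x_{i+n-1}\neq x_j\cdots x_{j+n-1}\text{ for all } 0\le i<j\le m-1\}$. -}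

module Defs where

open import Data.Nat using (ℕ; zero; suc; _+_; _*_; _<_; _≤_)
open import Data.List using (List; []; _∷_; _++_)
open import Data.Fin using (Fin; toℕ)
open import Data.Vec using (Vec; tabulate)
open import Data.Product using (_×_)
open import Relation.Binary.PropositionalEquality using (_≢_)

-- Finite words over the alphabet ℕ are lists; infinite words are maps ℕ → ℕ
-- (x i is the letter at index i, indexing from 0).
Word∞ : Set
Word∞ = ℕ → ℕ

Z : ℕ → List ℕ
Z zero    = []
Z (suc n) = Z n ++ (n ∷ Z n)

-- i-th letter of a finite word (0 if out of range; never used out of range below)
nth : ℕ → List ℕ → ℕ
nth _       []       = 0
nth zero    (a ∷ _)  = a
nth (suc i) (_ ∷ w)  = nth i w

-- The limit of the Z n: since Z n is a prefix of Z (n+1) and |Z (i+1)| = 2^(i+1) - 1 > i,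
-- the letter at index i is the i-th letter of Z (i+1).
ruler : Word∞
ruler i = nth i (Z (suc i))

factor : Word∞ → ℕ → (n : ℕ) → Vec ℕ n
factor x i n = tabulate (λ k → x (i + toℕ k))

Squarefree : Word∞ → Set
Squarefree x = ∀ i n → 1 ≤ n → factor x i n ≢ factor x (i + n) n

DistinctPrefix : Word∞ → ℕ → ℕ → Set
DistinctPrefix x n m = ∀ i j → i < j → j < m → factor x i n ≢ factor x j n

IsNsc : Word∞ → ℕ → ℕ → Set
IsNsc x n m = DistinctPrefix x n m × (∀ m′ → DistinctPrefix x n m′ → m′ ≤ m)

module Submission where

-- The ruler word x = ruler satisfies x_p = ν₂(p + 1), the exponent of 2 in p + 1:
--   k ≤ x_p  ⇔  2^k ∣ p + 1                                   (ruler-valuation)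
-- This is proved by induction on n for the prefixes Z n, using |Z n| = 2^n - 1 and the
-- decomposition Z (n+1) = Z n · n · Z n.  Everything else is read off this formula.
--
-- Key lemma (agreement⇒period): if x agrees with its shift by d on a window of length
-- 2^k, then 2^(k+1) ∣ d.  The window contains a position p with 2^k ∣ p + 1; equal
-- letters at p and p + d force 2^k ∣ d, and comparing divisibility by 2^(k+1) shows
-- that d / 2^k does not change the parity of (p + 1) / 2^k, so it is even.
--
-- For 2^k ≤ n < 2^(k+1), two equal length-n factors at distance d > 0 therefore have
-- d ≥ 2^(k+1) > n: no square uu with |u| = n exists, and the first 2^(k+1) length-n
-- factors are distinct.  Conversely x is 2^(k+1)-periodic on [0, 2^(k+1) - 1), so the
-- factor at 2^(k+1) repeats the one at 0.  Hence nsc(n) = 2^(k+1) ∈ (n, 2n].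

open import Defs
open import Level using (0ℓ)
open import Data.Nat using (ℕ; zero; suc; _+_; _*_; _^_; _<_; _≤_; z≤n; s≤s; z<s; NonZero; >-nonZero)
open import Data.Nat.Properties
open import Data.Nat.Divisibility
open import Data.List using (List; []; _∷_; _++_; length)
open import Data.List.Properties using (length-++)
open import Data.Product using (Σ; _×_; _,_)
open import Data.Empty using (⊥-elim)
open import Relation.Nullary using (¬_; yes; no)
open import Relation.Binary.PropositionalEquality
open import Relation.Binary using (tri<; tri≈; tri>)
open import Data.Fin using (toℕ; fromℕ<)
open import Data.Fin.Properties using (toℕ-fromℕ<; toℕ<n)
open import Data.Vec using (lookup)
open import Data.Vec.Properties using (lookup∘tabulate; tabulate-cong)
open import Function.Bundles using (_⇔_; mk⇔; Equivalence)
open import Function.Properties.Equivalence using (⇔-setoid)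
  renaming (sym to ⇔-sym; trans to ⇔-trans)
open import Algebra.Properties.CommutativeSemigroup +-commutativeSemigroup using (xy∙z≈xz∙y)
open Equivalence using (to; from)

import Relation.Binary.Reasoning.Setoid

module ⇔-Reasoning = Relation.Binary.Reasoning.Setoid (⇔-setoid 0ℓ)

nth-++ˡ : ∀ i (w v : List ℕ) → i < length w → nth i (w ++ v) ≡ nth i w
nth-++ˡ zero    (a ∷ w) v _       = refl
nth-++ˡ (suc i) (a ∷ w) v (s≤s p) = nth-++ˡ i w v p

nth-++ʳ : ∀ j (w v : List ℕ) → nth (length w + j) (w ++ v) ≡ nth j v
nth-++ʳ j []      v = refl
nth-++ʳ j (a ∷ w) v = nth-++ʳ j w v

-- |Z n| = 2^n - 1, stated without truncated subtraction.
length-Z : ∀ n → suc (length (Z n)) ≡ 2 ^ n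
length-Z zero    = refl
length-Z (suc n) = begin
    suc (length (Z n ++ n ∷ Z n))            ≡⟨ cong suc (length-++ (Z n)) ⟩
    suc (length (Z n)) + suc (length (Z n))  ≡⟨ cong₂ _+_ (length-Z n) (length-Z n) ⟩
    2 ^ n + 2 ^ n                            ≡⟨ cong (2 ^ n +_) (sym (+-identityʳ (2 ^ n))) ⟩
    2 ^ suc n                                ∎
  where open ≡-Reasoning

-- n < 2^n = |Z n| + 1; so ruler p = nth p (Z (p+1)) reads a letter inside Z (p+1).
n<2^n : ∀ n → n < 2 ^ n
n<2^n zero    = z<s
n<2^n (suc n) = ≤-<-trans (n<2^n n) (m<m+n (2 ^ n) (≤-trans (m^n>0 2 n) (m≤m+n (2 ^ n) 0)))

binary-magnitude : ∀ n → 1 ≤ n → Σ ℕ λ k → 2 ^ k ≤ n × n < 2 ^ suc k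
binary-magnitude (suc zero)    _ = 0 , ≤-refl , s≤s (s≤s z≤n)
binary-magnitude (suc (suc n)) _ with binary-magnitude (suc n) (s≤s z≤n)
... | k , lo , hi with suc (suc n) <? 2 ^ suc k
...   | yes below = k , m≤n⇒m≤1+n lo , below
...   | no ¬below = suc k , ≮⇒≥ ¬below ,
          ≤-<-trans hi (m<m+n (2 ^ suc k) (≤-trans (m^n>0 2 (suc k)) (m≤m+n (2 ^ suc k) 0)))

∣-shift : ∀ {d a m} → d ∣ a → (d ∣ m) ⇔ (d ∣ a + m)
∣-shift d∣a = mk⇔ (∣m∣n⇒∣m+n d∣a) (λ d∣a+m → ∣m+n∣m⇒∣n d∣a+m d∣a)

∤-below : ∀ {d m} → 0 < m → m < d → ¬ (d ∣ m)
∤-below 0<m m<d = >⇒∤ {{>-nonZero 0<m}} m<d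

*-cancelʳ-∣⇔ : ∀ d u o .{{_ : NonZero o}} → (d * o ∣ u * o) ⇔ (d ∣ u)
*-cancelʳ-∣⇔ d u o = mk⇔ (*-cancelʳ-∣ o) (*-monoˡ-∣ o)

2^-∣-2^ : ∀ k n → (k ≤ n) ⇔ (2 ^ k ∣ 2 ^ n)
2^-∣-2^ k n = mk⇔ pow-∣ pow-∣⁻¹
  where
  pow-∣ : k ≤ n → 2 ^ k ∣ 2 ^ n
  pow-∣ k≤n with m≤n⇒∃[o]m+o≡n k≤n
  ... | e , refl = divides (2 ^ e) (trans (^-distribˡ-+-* 2 k e) (*-comm (2 ^ k) (2 ^ e)))
  pow-∣⁻¹ : 2 ^ k ∣ 2 ^ n → k ≤ n
  pow-∣⁻¹ d = ≮⇒≥ λ n<k → ∤-below (m^n>0 2 n) (^-monoʳ-< 2 (s≤s (s≤s z≤n)) n<k) d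

-- Adding 2^n to a positive number below 2^n preserves divisibility by every 2^k:
-- for k ≤ n because 2^k ∣ 2^n, for k > n because neither number is a multiple of 2^k.
2^-∣-shift : ∀ n k j → suc j < 2 ^ n → (2 ^ k ∣ suc j) ⇔ (2 ^ k ∣ suc (2 ^ n + j))
2^-∣-shift n k j below with k ≤? n
... | yes k≤n = subst (λ m → (2 ^ k ∣ suc j) ⇔ (2 ^ k ∣ m)) (+-suc (2 ^ n) j)
                      (∣-shift (to (2^-∣-2^ k n) k≤n))
... | no k≰n = mk⇔ (λ d → ⊥-elim (∤-below z<s (<-≤-trans below 2^n≤2^k) d))
                   (λ d → ⊥-elim (∤-below z<s (<-≤-trans shifted-below 2^[n+1]≤2^k) d))
  where
  2^n≤2^k : 2 ^ n ≤ 2 ^ k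
  2^n≤2^k = ^-monoʳ-≤ 2 (<⇒≤ (≰⇒> k≰n))
  shifted-below : suc (2 ^ n + j) < 2 ^ suc n
  shifted-below = subst (_< 2 ^ suc n) (+-suc (2 ^ n) j)
                        (+-monoʳ-< (2 ^ n) (<-≤-trans below (m≤m+n (2 ^ n) 0)))
  2^[n+1]≤2^k : 2 ^ suc n ≤ 2 ^ k
  2^[n+1]≤2^k = ^-monoʳ-≤ 2 (≰⇒> k≰n)

nth-middle : ∀ n → nth (length (Z n)) (Z (suc n)) ≡ n
nth-middle n = trans (cong (λ q → nth q (Z n ++ n ∷ Z n)) (sym (+-identityʳ (length (Z n)))))
                     (nth-++ʳ 0 (Z n) (n ∷ Z n))

nth-second-half : ∀ n j → nth (suc (length (Z n)) + j) (Z (suc n)) ≡ nth j (Z n)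
nth-second-half n j = trans (cong (λ q → nth q (Z n ++ n ∷ Z n)) (sym (+-suc (length (Z n)) j)))
                            (nth-++ʳ (suc j) (Z n) (n ∷ Z n))

second-half-bound : ∀ n j → suc (length (Z n)) + j < length (Z (suc n)) → j < length (Z n)
second-half-bound n j i< = +-cancelˡ-< (suc L) j L
    (subst (suc L + j <_) (trans (length-++ (Z n)) (+-comm L (suc L))) i<)
  where L = length (Z n)

Z-valuation : ∀ n i → i < length (Z n) → ∀ k → (k ≤ nth i (Z n)) ⇔ (2 ^ k ∣ suc i)
Z-valuation zero    i ()  k
Z-valuation (suc n) i i< k with <-cmp i (length (Z n))
... | tri< first-half _ _ rewrite nth-++ˡ i (Z n) (n ∷ Z n) first-half = Z-valuation n i first-half k
... | tri≈ _ refl _ rewrite nth-middle n | length-Z n = 2^-∣-2^ k n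
... | tri> _ _ second-half with m≤n⇒∃[o]m+o≡n second-half
...   | j , refl rewrite nth-second-half n j = begin
          k ≤ nth j (Z n)                      ≈⟨ Z-valuation n j j< k ⟩
          2 ^ k ∣ suc j                        ≈⟨ 2^-∣-shift n k j (subst (suc j <_) (length-Z n) (s≤s j<)) ⟩
          2 ^ k ∣ suc (2 ^ n + j)              ≡⟨ cong (λ m → 2 ^ k ∣ suc (m + j)) (sym (length-Z n)) ⟩
          2 ^ k ∣ suc (suc (length (Z n)) + j) ∎
  where
  open ⇔-Reasoning
  j< : j < length (Z n)
  j< = second-half-bound n j i<

ruler-valuation : ∀ p k → (k ≤ ruler p) ⇔ (2 ^ k ∣ suc p)
ruler-valuation p k = Z-valuation (suc p) p p<|Z| k
  where
  p<|Z| : p < length (Z (suc p))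
  p<|Z| = ≤-pred (subst (suc p <_) (sym (length-Z (suc p))) (n<2^n (suc p)))

ruler-≡⇒∣⇔ : ∀ {p q} → ruler p ≡ ruler q → ∀ k → (2 ^ k ∣ suc p) ⇔ (2 ^ k ∣ suc q)
ruler-≡⇒∣⇔ {p} {q} eq k = begin
    2 ^ k ∣ suc p  ≈⟨ ⇔-sym (ruler-valuation p k) ⟩
    k ≤ ruler p    ≡⟨ cong (k ≤_) eq ⟩
    k ≤ ruler q    ≈⟨ ruler-valuation q k ⟩
    2 ^ k ∣ suc q  ∎
  where open ⇔-Reasoning

ruler-≤ : ∀ {p q} → (∀ k → 2 ^ k ∣ suc p → 2 ^ k ∣ suc q) → ruler p ≤ ruler q
ruler-≤ {p} {q} divides-q = from (ruler-valuation q (ruler p))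
  (divides-q (ruler p) (to (ruler-valuation p (ruler p)) ≤-refl))

∣⇔⇒ruler-≡ : ∀ {p q} → (∀ k → (2 ^ k ∣ suc p) ⇔ (2 ^ k ∣ suc q)) → ruler p ≡ ruler q
∣⇔⇒ruler-≡ same = ≤-antisym (ruler-≤ (λ k → to (same k))) (ruler-≤ (λ k → from (same k)))

ruler-periodic : ∀ n t → suc t < 2 ^ n → ruler (2 ^ n + t) ≡ ruler t
ruler-periodic n t below = ∣⇔⇒ruler-≡ (λ k → ⇔-sym (2^-∣-shift n k t below))

even-step : ∀ n → (2 ∣ n) ⇔ (2 ∣ 2 + n)
even-step n = ∣-shift ∣-refl

¬even-suc⇒even : ∀ w → ¬ (2 ∣ suc w) → 2 ∣ w
¬even-suc⇒even zero          _   = 2 ∣0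
¬even-suc⇒even (suc zero)    odd = ⊥-elim (odd ∣-refl)
¬even-suc⇒even (suc (suc w)) odd =
  to (even-step w) (¬even-suc⇒even w (λ e → odd (to (even-step (suc w)) e)))

parity-preserved⇒even : ∀ u w → (2 ∣ u) ⇔ (2 ∣ u + w) → 2 ∣ w
parity-preserved⇒even zero          w same = to same (2 ∣0)
parity-preserved⇒even (suc zero)    w same =
  ¬even-suc⇒even w (λ e → ∤-below z<s (s≤s (s≤s z≤n)) (from same e))
parity-preserved⇒even (suc (suc u)) w same = parity-preserved⇒even u w
  (⇔-trans (even-step u) (⇔-trans same (⇔-sym (even-step (u + w)))))

multiple-in-window : ∀ M b → 0 < M → Σ ℕ λ t → t < M × M ∣ b + t
multiple-in-window (suc M) zero    _ = 0 , z<s , suc M ∣0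
multiple-in-window (suc M) (suc b) _ with multiple-in-window (suc M) b z<s
... | zero  , _      , M∣b+0 = M , ≤-refl , subst (suc M ∣_) b+0+[1+M]≡1+b+M (∣m∣n⇒∣m+n M∣b+0 ∣-refl)
  where
  b+0+[1+M]≡1+b+M : b + 0 + suc M ≡ suc b + M
  b+0+[1+M]≡1+b+M = trans (cong (_+ suc M) (+-identityʳ b)) (+-suc b M)
... | suc t , 1+t<1+M , M∣b+1+t = t , <-trans (n<1+n t) 1+t<1+M , subst (suc M ∣_) (+-suc b t) M∣b+1+t

agreement⇒period : ∀ k a d → (∀ t → t < 2 ^ k → ruler (a + t) ≡ ruler (a + d + t)) → 2 ^ suc k ∣ d
agreement⇒period k a d agree with multiple-in-window (2 ^ k) (suc a) (m^n>0 2 k)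
... | t , t<K , K∣p+1 = subst (2 ^ suc k ∣_) (sym d≡w*K) (*-monoˡ-∣ K w-even)
  where
  K = 2 ^ k
  instance
    K≢0 : NonZero K
    K≢0 = m^n≢0 2 k
  -- p = a + t is a position of the window with 2^k ∣ p + 1; its partner is p + d
  same : ∀ j → (2 ^ j ∣ suc (a + t)) ⇔ (2 ^ j ∣ suc (a + t) + d)
  same j = subst (λ m → (2 ^ j ∣ suc (a + t)) ⇔ (2 ^ j ∣ suc m))
                 (xy∙z≈xz∙y a d t) (ruler-≡⇒∣⇔ (agree t t<K) j)
  K∣d : K ∣ d
  K∣d = ∣m+n∣m⇒∣n (to (same k) K∣p+1) K∣p+1
  u = quotient K∣p+1
  w = quotient K∣d
  d≡w*K : d ≡ w * K
  d≡w*K = m∣n⇒n≡quotient*m K∣d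
  w-even : 2 ∣ w
  w-even = parity-preserved⇒even u w (begin
      2 ∣ u                       ≈⟨ ⇔-sym (*-cancelʳ-∣⇔ 2 u K) ⟩
      2 ^ suc k ∣ u * K           ≡⟨ cong (2 ^ suc k ∣_) (sym (m∣n⇒n≡quotient*m K∣p+1)) ⟩
      2 ^ suc k ∣ suc (a + t)     ≈⟨ same (suc k) ⟩
      2 ^ suc k ∣ suc (a + t) + d ≡⟨ cong (2 ^ suc k ∣_) (cong₂ _+_ (m∣n⇒n≡quotient*m K∣p+1) d≡w*K) ⟩
      2 ^ suc k ∣ u * K + w * K   ≡⟨ cong (2 ^ suc k ∣_) (sym (*-distribʳ-+ K u w)) ⟩
      2 ^ suc k ∣ (u + w) * K     ≈⟨ *-cancelʳ-∣⇔ 2 (u + w) K ⟩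
      2 ∣ u + w                   ∎)
    where open ⇔-Reasoning

factor-≡⇒agree : ∀ (x : Word∞) i j n → factor x i n ≡ factor x j n → ∀ t → t < n → x (i + t) ≡ x (j + t)
factor-≡⇒agree x i j n eq t t<n = begin
    x (i + t)                ≡⟨ cong (λ q → x (i + q)) (sym (toℕ-fromℕ< t<n)) ⟩
    x (i + toℕ f)            ≡⟨ sym (lookup∘tabulate (λ s → x (i + toℕ s)) f) ⟩
    lookup (factor x i n) f  ≡⟨ cong (λ v → lookup v f) eq ⟩
    lookup (factor x j n) f  ≡⟨ lookup∘tabulate (λ s → x (j + toℕ s)) f ⟩
    x (j + toℕ f)            ≡⟨ cong (λ q → x (j + q)) (toℕ-fromℕ< t<n) ⟩
    x (j + t)                ∎
  where
  open ≡-Reasoning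
  f = fromℕ< t<n

repetition-distance : ∀ k n i d → 2 ^ k ≤ n → 0 < d →
                      factor ruler i n ≡ factor ruler (i + d) n → 2 ^ suc k ≤ d
repetition-distance k n i d 2^k≤n 0<d eq = ∣⇒≤ {{>-nonZero 0<d}} (agreement⇒period k i d
  (λ t t<2^k → factor-≡⇒agree ruler i (i + d) n eq t (<-≤-trans t<2^k 2^k≤n)))

-- A square uu with 2^k ≤ |u| < 2^(k+1) would be a repetition at distance |u| < 2^(k+1).
ruler-squarefree : Squarefree ruler
ruler-squarefree i n 1≤n square with binary-magnitude n 1≤n
... | k , 2^k≤n , n<2^[k+1] = <⇒≱ n<2^[k+1] (repetition-distance k n i n 2^k≤n 1≤n square)

ruler-distinct : ∀ k n → 2 ^ k ≤ n → DistinctPrefix ruler n (2 ^ suc k)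
ruler-distinct k n 2^k≤n i j i<j j<2^[k+1] eq with m≤n⇒∃[o]m+o≡n i<j
... | e , refl = <⇒≱ j<2^[k+1]
      (≤-trans (repetition-distance k n i (suc e) 2^k≤n z<s eq′) (s≤s (m≤n+m e i)))
  where
  eq′ : factor ruler i n ≡ factor ruler (i + suc e) n
  eq′ = subst (λ q → factor ruler i n ≡ factor ruler q n) (sym (+-suc i e)) eq

ruler-repeats : ∀ k n → n < 2 ^ suc k → factor ruler 0 n ≡ factor ruler (2 ^ suc k) n
ruler-repeats k n n<2^[k+1] =
  tabulate-cong (λ s → sym (ruler-periodic (suc k) (toℕ s) (≤-<-trans (toℕ<n s) n<2^[k+1])))

ruler-nsc : ∀ k n → 2 ^ k ≤ n → n < 2 ^ suc k → IsNsc ruler n (2 ^ suc k)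
ruler-nsc k n 2^k≤n n<2^[k+1] = ruler-distinct k n 2^k≤n , maximal
  where
  maximal : ∀ m′ → DistinctPrefix ruler n m′ → m′ ≤ 2 ^ suc k
  maximal m′ distinct = ≮⇒≥ λ 2^[k+1]<m′ →
    distinct 0 (2 ^ suc k) (m^n>0 2 (suc k)) 2^[k+1]<m′ (ruler-repeats k n n<2^[k+1])

mainTheorem14 : Squarefree ruler
    × (∀ (n : ℕ) → 1 ≤ n → Σ ℕ (λ m → IsNsc ruler n m × n < m × m ≤ 2 * n))
mainTheorem14 = ruler-squarefree , nsc-bounds
  where
  nsc-bounds : ∀ (n : ℕ) → 1 ≤ n → Σ ℕ (λ m → IsNsc ruler n m × n < m × m ≤ 2 * n)
  nsc-bounds n 1≤n with binary-magnitude n 1≤n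
  ... | k , 2^k≤n , n<2^[k+1] =
    2 ^ suc k , ruler-nsc k n 2^k≤n n<2^[k+1] , n<2^[k+1] , *-monoʳ-≤ 2 2^k≤n
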